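{- Let $n\in\mathbb{N}$ and let $u,v\in\mathcal{A}_n^*$ with $\mathrm{wt}(u)=\mathrm{wt}(v)$. Then $u$ and $v$ are $o$-conjugate in the hypoplactic monoid of rank $n$: there exist $g,h\in\mathcal{A}_n^*$ with $ug\equiv_{\mathrm{hypo}} gv$ and $hu\equiv_{\mathrm{hypo}} vh$.
   Context: $\mathcal{A}_n=\{1<\dots<n\}$; $\mathrm{wt}(u)=(|u|_1,\dots,|u|_n)$ counts occurrences of each letter. A ribbon diagram of shape a composition $(\alpha_1,\dots,\alpha_k)$ has $\alpha_h$ boxes in row $h$, leftmost box of each row directly below the rightmost box of the previous row. A quasi-ribbon tableau is such a diagram filled with positive integers, rows weakly increasing left to right, columns strictly increasing top to bottom. Insertion of $a$ into $T$: if no entry of $T$ is $\le a$ (or $T$ empty), create a cell $a$ with $T$ attached so its first cell is directly below $a$; if no entry is $>a$, attach a new cell $a$ directly right of the last cell of $T$; otherwise let $x$ be the last cell (along the ribbon, top-left to bottom-right) with entry $\le a$ and $z$ the next cell, and form the part of $T$ up to $x$, a new cell $a$ directly right of $x$, and the rest of $T$ from $z$ attached with $z$ directly below the new cell. $\mathrm{QR}(w)$ is obtained by successive insertion of the letters of $w$ into the empty tableau; $u\equiv_{\mathrm{hypo}}v$ iff $\mathrm{QR}(u)=\mathrm{QR}(v)$; the hypoplactic monoid of rank $n$ is $\mathcal{A}_n^*/{\equiv_{\mathrm{hypo}}}$. In a monoid $M$, $x,y$ are $o$-conjugate if there exist $g,h\in M$ with $xg=gy$ and $hx=yh$. -}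

module Defs where

open import Data.Nat using (ℕ)
open import Data.Fin using (Fin)
open import Data.Fin.Properties using (_≤?_; _≟_)
open import Data.List using (List; []; _∷_; _++_; [_]; length; filter; foldl; takeWhile; dropWhile)
open import Data.Vec using (Vec; tabulate)
open import Data.Bool using (Bool; true; false; if_then_else_)
open import Relation.Nullary using (does; ¬?)
open import Relation.Binary.PropositionalEquality using (_≡_)
open import Data.Product using (Σ; _×_)

Word : ℕ → Set
Word n = List (Fin n)

wt : ∀ {n} → Word n → Vec ℕ n
wt u = tabulate (λ i → length (filter (λ x → x ≟ i) u))

-- A quasi-ribbon tableau is represented by its list of rows (top to bottom),
-- each row listing its entries left to right.  The shape (a composition) is
-- the list of row lengths; the ribbon placement is implicit.
QRTableau : ℕ → Set
QRTableau n = List (List (Fin n))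

private
  _≤ᵇ_ : ∀ {n} → Fin n → Fin n → Bool
  x ≤ᵇ y = does (x ≤? y)

  -- first entry of T (along the ribbon) is > a, or T is empty:
  -- since entries weakly increase along the ribbon, this means "no entry ≤ a".
  noneLeq : ∀ {n} → Fin n → QRTableau n → Bool
  noneLeq a [] = true
  noneLeq a ([] ∷ rs) = noneLeq a rs
  noneLeq a ((x ∷ _) ∷ _) = if x ≤ᵇ a then false else true

  go : ∀ {n} → Fin n → QRTableau n → QRTableau n
  go a [] = [ [ a ] ]
  go a (r ∷ rs) with dropWhile (λ y → y ≤? a) r
  ... | s@(_ ∷ _) = (takeWhile (λ y → y ≤? a) r ++ [ a ]) ∷ s ∷ rs
  ... | [] = if noneLeq a rs then (r ++ [ a ]) ∷ rs else r ∷ go a rs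

-- Insertion of a letter a into a quasi-ribbon tableau T, as in the paper:
--  * no entry ≤ a (or T empty): new cell a with T attached below it;
--  * no entry > a: new cell a right of the last cell;
--  * otherwise: new cell a right of x (last cell ≤ a), rest of T from z
--    attached with z directly below the new cell.
insert : ∀ {n} → Fin n → QRTableau n → QRTableau n
insert a T = if noneLeq a T then [ a ] ∷ T else go a T

QR : ∀ {n} → Word n → QRTableau n
QR w = foldl (λ T a → insert a T) [] w

_≡hypo_ : ∀ {n} → Word n → Word n → Set
u ≡hypo v = QR u ≡ QR v

OConjugate : ∀ {n} → Word n → Word n → Set
OConjugate {n} u v =
  Σ (Word n) (λ g → Σ (Word n) (λ h → ((u ++ g) ≡hypo (g ++ v)) × ((h ++ u) ≡hypo (v ++ h))))

-- Take g = h = n⋯21, the decreasing word.  Both QR(w·g) and QR(g·w) are the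
-- tableau with rows 1^(c₁+1), 2^(c₂+1), …, n^(cₙ+1), where c = wt(w), so they
-- depend on wt(w) only.  Inserting g into the empty tableau gives one row per
-- letter, and each later letter a is appended to the row of a.  Conversely, in
-- a quasi-ribbon tableau with entries ≤ h the cells h end its last row, so
-- inserting h - 1 puts it just before them and pushes them into a row of their
-- own; thus inserting n, n - 1, …, 1 into QR(w) sorts it into rows of equal
-- letters.  Insertion permutes the cells, so the row lengths come from wt(w).
module Submission where

open import Defs
open import Data.Bool using (Bool; true; false; not; if_then_else_)
open import Data.Empty using (⊥; ⊥-elim)
open import Data.Fin using (Fin; toℕ; fromℕ<; _≤_; _<_)
open import Data.Fin.Properties using (_≤?_; _≟_; toℕ-fromℕ<; fromℕ<-toℕ; toℕ<n; ≤-antisym; <⇒≢)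
open import Data.List using (List; []; _∷_; _++_; [_]; length; filter; foldl; concat; replicate; takeWhile; dropWhile)
open import Data.List.Properties using (++-assoc; ++-identityʳ; concat-++; foldl-++; length-++; filter-++; filter-none; filter-some; takeWhile++dropWhile)
open import Data.List.Relation.Unary.All as All using (All; []; _∷_)
open import Data.List.Relation.Unary.All.Properties as All using (replicate⁺)
open import Data.List.Relation.Unary.Any using (Any; here)
open import Data.List.Relation.Unary.Any.Properties as Any using ()
open import Data.List.Relation.Binary.Permutation.Propositional using (_↭_; ↭-refl; ↭-reflexive; ↭-sym; ↭-trans; module PermutationReasoning)
open import Data.List.Relation.Binary.Permutation.Propositional.Properties as ↭ using (shift; filter-↭; ↭-length)
open import Data.Nat as ℕ using (ℕ; zero; suc; _+_; z≤n; s≤s; s≤s⁻¹)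
open import Data.Nat.Properties as ℕ using (+-assoc; +-identityʳ; +-cancelʳ-≡; <⇒≤; <⇒≱; m≤n⇒m<n∨m≡n)
open import Data.Product using (∃₂; ∃-syntax; _×_; _,_; proj₁; proj₂)
open import Data.Sum using (_⊎_; inj₁; inj₂)
open import Data.Unit using (⊤; tt)
open import Data.Vec using (Vec; lookup)
open import Data.Vec.Properties using (lookup∘tabulate)
open import Relation.Nullary using (does; yes; no; contradiction)
open import Relation.Nullary.Decidable using (dec-true; dec-false)
open import Relation.Binary.PropositionalEquality hiding ([_])

module _ {n : ℕ} where

  Row : Set
  Row = List (Fin n)

  Tableau : Set
  Tableau = QRTableau n

  -- Defs.insert, restated through public helpers since those of Defs are
  -- private; the two agree on quasi-ribbon tableaux (insert≡insert′).
  firstAbove : Fin n → Tableau → Bool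
  firstAbove a []             = true
  firstAbove a ([] ∷ rs)      = firstAbove a rs
  firstAbove a ((x ∷ _) ∷ _)  = not (does (x ≤? a))

  mutual
    bump : Fin n → Tableau → Tableau
    bump a []       = [ [ a ] ]
    bump a (r ∷ rs) = bumpRow a r rs (dropWhile (_≤? a) r)

    bumpRow : Fin n → Row → Tableau → Row → Tableau
    bumpRow a r rs (z ∷ zs) = (takeWhile (_≤? a) r ++ [ a ]) ∷ (z ∷ zs) ∷ rs
    bumpRow a r rs []       = if firstAbove a rs then (r ++ [ a ]) ∷ rs else r ∷ bump a rs

  insert′ : Fin n → Tableau → Tableau
  insert′ a T = if firstAbove a T then [ a ] ∷ T else bump a T

  insertAll : Tableau → Word n → Tableau
  insertAll = foldl (λ T a → insert′ a T)

  -- Read along the ribbon, the entries increase weakly inside a row and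
  -- strictly from the last cell of a row to the first cell of the next one
  -- (the column condition); rows are nonempty and entries are at least l.
  -- In IsRibbonRow x r rs, x is the entry preceding the cells r.
  mutual
    IsRibbon : ℕ → Tableau → Set
    IsRibbon l []              = ⊤
    IsRibbon l ([] ∷ rs)       = ⊥
    IsRibbon l ((y ∷ ys) ∷ rs) = IsRibbonRow l (y ∷ ys) rs

    IsRibbonRow : ℕ → Row → Tableau → Set
    IsRibbonRow x []       rs = IsRibbon (suc x) rs
    IsRibbonRow x (y ∷ ys) rs = x ℕ.≤ toℕ y × IsRibbonRow (toℕ y) ys rs

  IsRibbonRow-rest : ∀ {x} r {rs} → IsRibbonRow x r rs → ∃[ l ] IsRibbon l rs
  IsRibbonRow-rest {x} []       ρ       = suc x , ρ
  IsRibbonRow-rest      (_ ∷ ys) (_ , ρ) = IsRibbonRow-rest ys ρ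

  IsRibbonRow-tail : ∀ {x} r {rs rs′} → IsRibbonRow x r rs → (∀ {l} → IsRibbon l rs → IsRibbon l rs′)
                   → IsRibbonRow x r rs′
  IsRibbonRow-tail []       ρ         f = f ρ
  IsRibbonRow-tail (_ ∷ ys) (x≤y , ρ) f = x≤y , IsRibbonRow-tail ys ρ f

  IsRibbon-++⁻ˡ : ∀ {l} P {Q} → IsRibbon l (P ++ Q) → IsRibbon l P
  IsRibbon-++⁻ˡ []             _ = tt
  IsRibbon-++⁻ˡ ((y ∷ ys) ∷ P) ρ = IsRibbonRow-tail (y ∷ ys) ρ (IsRibbon-++⁻ˡ P)

  IsRibbonRow⇒IsRibbon : ∀ {l} r (a : Fin n) {rs} → IsRibbonRow l (r ++ [ a ]) rs → IsRibbon l ((r ++ [ a ]) ∷ rs)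
  IsRibbonRow⇒IsRibbon []      a ρ = ρ
  IsRibbonRow⇒IsRibbon (_ ∷ _) a ρ = ρ

  insert≡insert′ : ∀ {l} a T → IsRibbon l T → insert a T ≡ insert′ a T
  insert≡insert′ a [] _ = refl
  -- Both sides reduce to case splits on ℕ.≤ᵇ, so splitting on it runs them in lockstep.
  insert≡insert′ a ((y ∷ ys) ∷ rs) ρ with toℕ y ℕ.≤ᵇ toℕ a
  ... | false = refl
  ... | true with dropWhile (_≤? a) ys
  ...   | _ ∷ _ = refl
  ...   | [] with rs | IsRibbonRow-rest (y ∷ ys) ρ
  ...     | []             | _ = refl
  ...     | [] ∷ _         | _ , ()
  ...     | (z ∷ zs) ∷ rs′ | _ , ρ′ with toℕ z ℕ.≤ᵇ toℕ a | insert≡insert′ a ((z ∷ zs) ∷ rs′) ρ′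
  ...       | false | _  = refl
  ...       | true  | ih = cong ((y ∷ ys) ∷_) ih

  ≤∨> : (x y : Fin n) → x ≤ y ⊎ y < x
  ≤∨> x y with x ≤? y
  ... | yes x≤y = inj₁ x≤y
  ... | no  x≰y = inj₂ (ℕ.≰⇒> x≰y)

  module _ {a : Fin n} where

    dropWhile-≤ : ∀ {z : Fin n} zs → z ≤ a → dropWhile (_≤? a) (z ∷ zs) ≡ dropWhile (_≤? a) zs
    dropWhile-≤ {z} zs z≤a rewrite dec-true (z ≤? a) z≤a = refl

    dropWhile-> : ∀ {z : Fin n} zs → a < z → dropWhile (_≤? a) (z ∷ zs) ≡ z ∷ zs
    dropWhile-> {z} zs a<z rewrite dec-false (z ≤? a) (<⇒≱ a<z) = refl

    takeWhile-≤ : ∀ {z : Fin n} zs → z ≤ a → takeWhile (_≤? a) (z ∷ zs) ≡ z ∷ takeWhile (_≤? a) zs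
    takeWhile-≤ {z} zs z≤a rewrite dec-true (z ≤? a) z≤a = refl

    takeWhile-> : ∀ {z : Fin n} zs → a < z → takeWhile (_≤? a) (z ∷ zs) ≡ []
    takeWhile-> {z} zs a<z rewrite dec-false (z ≤? a) (<⇒≱ a<z) = refl

    firstAbove-≤ : ∀ {z : Fin n} zs T → z ≤ a → firstAbove a ((z ∷ zs) ∷ T) ≡ false
    firstAbove-≤ {z} zs T z≤a rewrite dec-true (z ≤? a) z≤a = refl

    firstAbove-> : ∀ {z : Fin n} zs T → a < z → firstAbove a ((z ∷ zs) ∷ T) ≡ true
    firstAbove-> {z} zs T a<z rewrite dec-false (z ≤? a) (<⇒≱ a<z) = refl

    firstAbove≡false⇒≤ : ∀ {l} T → IsRibbon l T → firstAbove a T ≡ false → l ℕ.≤ toℕ a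
    firstAbove≡false⇒≤ ((y ∷ ys) ∷ rs) (l≤y , _) fa with ≤∨> y a
    ... | inj₁ y≤a = ℕ.≤-trans l≤y y≤a
    ... | inj₂ a<y = contradiction (trans (sym (firstAbove-> ys rs a<y)) fa) λ ()

    firstAbove≡true⇒IsRibbon : ∀ {l} T → IsRibbon l T → firstAbove a T ≡ true → IsRibbon (suc (toℕ a)) T
    firstAbove≡true⇒IsRibbon [] _ _ = tt
    firstAbove≡true⇒IsRibbon ((y ∷ ys) ∷ rs) (_ , ρ) fa with ≤∨> y a
    ... | inj₁ y≤a = contradiction (trans (sym (firstAbove-≤ ys rs y≤a)) fa) λ ()
    ... | inj₂ a<y = a<y , ρ

    dropWhile≡[] : ∀ r → dropWhile (_≤? a) r ≡ [] → All (_≤ a) r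
    dropWhile≡[] []       _  = []
    dropWhile≡[] (z ∷ zs) dw with ≤∨> z a
    ... | inj₁ z≤a = z≤a ∷ dropWhile≡[] zs (trans (sym (dropWhile-≤ zs z≤a)) dw)
    ... | inj₂ a<z = contradiction (trans (sym (dropWhile-> zs a<z)) dw) λ ()

    split-IsRibbonRow : ∀ {x} r {rs s ss} → IsRibbonRow x r rs → x ℕ.≤ toℕ a → dropWhile (_≤? a) r ≡ s ∷ ss
                      → IsRibbonRow x (takeWhile (_≤? a) r ++ [ a ]) ((s ∷ ss) ∷ rs)
    split-IsRibbonRow (z ∷ zs) (x≤z , ρ) x≤a dw with ≤∨> z a
    ... | inj₁ z≤a rewrite takeWhile-≤ zs z≤a =
      x≤z , split-IsRibbonRow zs ρ z≤a (trans (sym (dropWhile-≤ zs z≤a)) dw)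
    ... | inj₂ a<z with trans (sym (dropWhile-> zs a<z)) dw
    ...   | refl rewrite takeWhile-> zs a<z = x≤a , a<z , ρ

    snoc-IsRibbonRow : ∀ {x} r {rs} → IsRibbonRow x r rs → x ℕ.≤ toℕ a → All (_≤ a) r
                     → IsRibbon (suc (toℕ a)) rs → IsRibbonRow x (r ++ [ a ]) rs
    snoc-IsRibbonRow []       _         x≤a []          ρ′ = x≤a , ρ′
    snoc-IsRibbonRow (_ ∷ zs) (x≤z , ρ) _   (z≤a ∷ zs≤a) ρ′ = x≤z , snoc-IsRibbonRow zs ρ z≤a zs≤a ρ′

    bump-IsRibbon : ∀ {l} T → IsRibbon l T → firstAbove a T ≡ false → IsRibbon l (bump a T)
    bump-IsRibbon ((y ∷ ys) ∷ rs) ρ fa with dropWhile (_≤? a) (y ∷ ys) in dw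
    ... | s ∷ ss = IsRibbonRow⇒IsRibbon (takeWhile (_≤? a) (y ∷ ys)) a
                     (split-IsRibbonRow (y ∷ ys) ρ (firstAbove≡false⇒≤ ((y ∷ ys) ∷ rs) ρ fa) dw)
    ... | [] with firstAbove a rs in fa′
    ...   | true  = IsRibbonRow⇒IsRibbon (y ∷ ys) a
                      (snoc-IsRibbonRow (y ∷ ys) ρ (firstAbove≡false⇒≤ ((y ∷ ys) ∷ rs) ρ fa) (dropWhile≡[] (y ∷ ys) dw)
                        (firstAbove≡true⇒IsRibbon rs (proj₂ (IsRibbonRow-rest (y ∷ ys) ρ)) fa′))
    ...   | false = IsRibbonRow-tail (y ∷ ys) ρ (λ ρ′ → bump-IsRibbon rs ρ′ fa′)

    insert′-IsRibbon : ∀ T → IsRibbon 0 T → IsRibbon 0 (insert′ a T)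
    insert′-IsRibbon T ρ with firstAbove a T in fa
    ... | true  = z≤n , firstAbove≡true⇒IsRibbon T ρ fa
    ... | false = bump-IsRibbon T ρ fa

  bump-↭ : ∀ a T → concat (bump a T) ↭ a ∷ concat T
  bump-↭ a []       = ↭-refl
  bump-↭ a (r ∷ rs) with dropWhile (_≤? a) r in dw
  ... | s ∷ ss = begin
    (low ++ [ a ]) ++ (s ∷ ss) ++ concat rs
      ≡⟨ ++-assoc low [ a ] _ ⟩
    low ++ [ a ] ++ (s ∷ ss) ++ concat rs
      ↭⟨ shift a low _ ⟩
    a ∷ low ++ (s ∷ ss) ++ concat rs
      ≡⟨ cong (λ high → a ∷ low ++ high ++ concat rs) dw ⟨
    a ∷ low ++ dropWhile (_≤? a) r ++ concat rs
      ≡⟨ cong (a ∷_) (++-assoc low _ _) ⟨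
    a ∷ (low ++ dropWhile (_≤? a) r) ++ concat rs
      ≡⟨ cong (λ r′ → a ∷ r′ ++ concat rs) (takeWhile++dropWhile (_≤? a) r) ⟩
    a ∷ r ++ concat rs ∎
    where
    open PermutationReasoning
    low = takeWhile (_≤? a) r
  ... | [] with firstAbove a rs
  ...   | true  = ↭-trans (↭-reflexive (++-assoc r [ a ] _)) (shift a r _)
  ...   | false = ↭-trans (↭.++⁺ˡ r (bump-↭ a rs)) (shift a r _)

  insert′-↭ : ∀ a T → concat (insert′ a T) ↭ a ∷ concat T
  insert′-↭ a T with firstAbove a T
  ... | true  = ↭-refl
  ... | false = bump-↭ a T

  insertAll-↭ : ∀ T w → concat (insertAll T w) ↭ w ++ concat T
  insertAll-↭ T []      = ↭-refl
  insertAll-↭ T (x ∷ w) =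
    ↭-trans (insertAll-↭ (insert′ x T) w) (↭-trans (↭.++⁺ˡ w (insert′-↭ x T)) (shift x w _))

  count : Fin n → Row → ℕ
  count i xs = length (filter (_≟ i) xs)

  count-++ : ∀ i xs ys → count i (xs ++ ys) ≡ count i xs + count i ys
  count-++ i xs ys = trans (cong length (filter-++ (_≟ i) xs ys)) (length-++ (filter (_≟ i) xs))

  count-↭ : ∀ i {xs ys} → xs ↭ ys → count i xs ≡ count i ys
  count-↭ i xs↭ys = ↭-length (filter-↭ (_≟ i) xs↭ys)

  count-≡ : ∀ i xs → count i (i ∷ xs) ≡ suc (count i xs)
  count-≡ i xs with i ≟ i
  ... | yes _   = refl
  ... | no  i≢i = contradiction refl i≢i

  count-≢ : ∀ {x i} xs → x ≢ i → count i (x ∷ xs) ≡ count i xs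
  count-≢ {x} {i} xs x≢i with x ≟ i
  ... | yes x≡i = contradiction x≡i x≢i
  ... | no  _   = refl

  count-none : ∀ i {xs} → All (_≢ i) xs → count i xs ≡ 0
  count-none i xs≢i = cong length (filter-none (_≟ i) xs≢i)

  All≡⇒replicate : ∀ {i xs} → All (_≡ i) xs → xs ≡ replicate (count i xs) i
  All≡⇒replicate         []            = refl
  All≡⇒replicate {i} {xs = _ ∷ xs} (refl ∷ xs≡i) =
    trans (cong (i ∷_) (All≡⇒replicate xs≡i)) (cong (λ m → replicate m i) (sym (count-≡ i xs)))

  content : Tableau → Fin n → ℕ
  content T i = count i (concat T)

  content-++ : ∀ T U i → content (T ++ U) i ≡ content T i + content U i
  content-++ T U i = trans (cong (count i) (sym (concat-++ T U))) (count-++ i (concat T) _)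

  content-insert′ : ∀ a T i → content (insert′ a T) i ≡ count i [ a ] + content T i
  content-insert′ a T i = trans (count-↭ i (insert′-↭ a T)) (count-++ i [ a ] (concat T))

  content-insertAll : ∀ T w i → content (insertAll T w) i ≡ count i w + content T i
  content-insertAll T w i = trans (count-↭ i (insertAll-↭ T w)) (count-++ i w (concat T))

  module _ {a : Fin n} where

    dropWhile-All : ∀ {r} → All (_≤ a) r → dropWhile (_≤? a) r ≡ []
    dropWhile-All []           = refl
    dropWhile-All (z≤a ∷ r≤a) = trans (dropWhile-≤ _ z≤a) (dropWhile-All r≤a)

    dropWhile-++ : ∀ {r} s → All (_≤ a) r → dropWhile (_≤? a) (r ++ s) ≡ dropWhile (_≤? a) s
    dropWhile-++ s []           = refl
    dropWhile-++ s (z≤a ∷ r≤a) = trans (dropWhile-≤ _ z≤a) (dropWhile-++ s r≤a)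

    takeWhile-++ : ∀ {r} s → All (_≤ a) r → takeWhile (_≤? a) (r ++ s) ≡ r ++ takeWhile (_≤? a) s
    takeWhile-++ s []           = refl
    takeWhile-++ s (z≤a ∷ r≤a) = trans (takeWhile-≤ _ z≤a) (cong (_ ∷_) (takeWhile-++ s r≤a))

    firstAbove-++ : ∀ {Lo} R → All (All (_≤ a)) Lo → firstAbove a R ≡ false → firstAbove a (Lo ++ R) ≡ false
    firstAbove-++ R []                 fa = fa
    firstAbove-++ R ([] ∷ Lo≤a)        fa = firstAbove-++ R Lo≤a fa
    firstAbove-++ {(_ ∷ zs) ∷ Lo} R ((z≤a ∷ _) ∷ _) _ = firstAbove-≤ zs (Lo ++ R) z≤a

    bump-++ : ∀ {Lo} R → All (All (_≤ a)) Lo → firstAbove a R ≡ false → bump a (Lo ++ R) ≡ Lo ++ bump a R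
    bump-++ R []          fa = refl
    bump-++ {r ∷ _} R (r≤a ∷ Lo≤a) fa rewrite dropWhile-All r≤a | firstAbove-++ R Lo≤a fa =
      cong (r ∷_) (bump-++ R Lo≤a fa)

    insert′-++ : ∀ {Lo} R → All (All (_≤ a)) Lo → firstAbove a R ≡ false → insert′ a (Lo ++ R) ≡ Lo ++ bump a R
    insert′-++ R Lo≤a fa rewrite firstAbove-++ R Lo≤a fa = bump-++ R Lo≤a fa

    insert′-above : ∀ T → firstAbove a T ≡ true → insert′ a T ≡ [ a ] ∷ T
    insert′-above T fa rewrite fa = refl

    bump-append : ∀ {r} R → All (_≤ a) r → firstAbove a R ≡ true → bump a (r ∷ R) ≡ (r ++ [ a ]) ∷ R
    bump-append R r≤a fa rewrite dropWhile-All r≤a | fa = refl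

    bump-split : ∀ {r z} zs R → All (_≤ a) r → a < z
               → bump a ((r ++ z ∷ zs) ∷ R) ≡ (r ++ [ a ]) ∷ (z ∷ zs) ∷ R
    bump-split {r} {z} zs R r≤a a<z = begin
      bumpRow a (r ++ z ∷ zs) R (dropWhile (_≤? a) (r ++ z ∷ zs))
        ≡⟨ cong (bumpRow a (r ++ z ∷ zs) R) (trans (dropWhile-++ (z ∷ zs) r≤a) (dropWhile-> zs a<z)) ⟩
      (takeWhile (_≤? a) (r ++ z ∷ zs) ++ [ a ]) ∷ (z ∷ zs) ∷ R
        ≡⟨ cong (λ low → (low ++ [ a ]) ∷ (z ∷ zs) ∷ R) lowPart ⟩
      (r ++ [ a ]) ∷ (z ∷ zs) ∷ R ∎
      where
      open ≡-Reasoning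
      lowPart : takeWhile (_≤? a) (r ++ z ∷ zs) ≡ r
      lowPart = trans (takeWhile-++ (z ∷ zs) r≤a)
                      (trans (cong (r ++_) (takeWhile-> zs a<z)) (++-identityʳ r))

  replicate-∷ʳ : ∀ m (x : Fin n) → replicate m x ++ [ x ] ≡ replicate (suc m) x
  replicate-∷ʳ zero    x = refl
  replicate-∷ʳ (suc m) x = cong (x ∷_) (replicate-∷ʳ m x)

  row : (Fin n → ℕ) → Fin n → Row
  row c x = replicate (suc (c x)) x

  stack : (Fin n → ℕ) → List (Fin n) → Tableau → Tableau
  stack c []       T = T
  stack c (x ∷ xs) T = stack c xs (row c x ∷ T)

  stack-++ : ∀ c xs T → stack c xs T ≡ stack c xs [] ++ T
  stack-++ c []       T = refl
  stack-++ c (x ∷ xs) T = begin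
    stack c xs (row c x ∷ T)             ≡⟨ stack-++ c xs _ ⟩
    stack c xs [] ++ row c x ∷ T         ≡⟨ ++-assoc (stack c xs []) [ row c x ] T ⟨
    (stack c xs [] ++ [ row c x ]) ++ T  ≡⟨ cong (_++ T) (stack-++ c xs [ row c x ]) ⟨
    stack c xs [ row c x ] ++ T          ∎
    where open ≡-Reasoning

  stack-cong : ∀ {c c′} xs T → All (λ i → c i ≡ c′ i) xs → stack c xs T ≡ stack c′ xs T
  stack-cong []       T []       = refl
  stack-cong {c′ = c′} (x ∷ xs) T (e ∷ es) =
    trans (stack-cong xs _ es) (cong (λ m → stack c′ xs (replicate (suc m) x ∷ T)) e)

  stack-All : ∀ {P : Fin n → Set} c {xs T} → All P xs → All (All P) T → All (All P) (stack c xs T)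
  stack-All c []          T-P = T-P
  stack-All c (px ∷ xs-P) T-P = stack-All c xs-P (replicate⁺ _ px ∷ T-P)

  lettersBelow : (k : ℕ) → k ℕ.≤ n → List (Fin n)
  lettersBelow zero    _   = []
  lettersBelow (suc k) k<n = fromℕ< k<n ∷ lettersBelow k (<⇒≤ k<n)

  lettersBelow-< : ∀ k (k≤n : k ℕ.≤ n) → All (λ i → toℕ i ℕ.< k) (lettersBelow k k≤n)
  lettersBelow-< zero    _   = []
  lettersBelow-< (suc k) k<n =
    ℕ.≤-reflexive (cong suc (toℕ-fromℕ< k<n)) ∷ All.map ℕ.m<n⇒m<1+n (lettersBelow-< k (<⇒≤ k<n))

  decreasing : Word n
  decreasing = lettersBelow n ℕ.≤-refl

  +-count-≢ : ∀ (c : Fin n → ℕ) {a i} → a ≢ i → c i + count i [ a ] ≡ c i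
  +-count-≢ c {i = i} a≢i = trans (cong (c i +_) (count-≢ [] a≢i)) (+-identityʳ (c i))

  insert′-stack : ∀ c {a} k (k≤n : k ℕ.≤ n) T → toℕ a ℕ.< k → firstAbove a T ≡ true
                → insert′ a (stack c (lettersBelow k k≤n) T)
                  ≡ stack (λ i → c i + count i [ a ]) (lettersBelow k k≤n) T
  insert′-stack c {a} (suc k) k<n T a<1+k fa with m≤n⇒m<n∨m≡n (s≤s⁻¹ a<1+k)
  ... | inj₁ a<k = trans (insert′-stack c k (<⇒≤ k<n) _ a<k (firstAbove-> {a} {x} (replicate (c x) x) T a<x))
                         (cong (λ m → stack c′ L (replicate (suc m) x ∷ T)) (sym (+-count-≢ c (<⇒≢ a<x))))
    where
    x = fromℕ< k<n
    L = lettersBelow k (<⇒≤ k<n)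
    c′ = λ i → c i + count i [ a ]
    a<x : a < x
    a<x = subst (toℕ a ℕ.<_) (sym (toℕ-fromℕ< k<n)) a<k
  ... | inj₂ refl rewrite fromℕ<-toℕ a k<n = begin
    insert′ a (stack c L (row c a ∷ T))
      ≡⟨ cong (insert′ a) (stack-++ c L _) ⟩
    insert′ a (stack c L [] ++ row c a ∷ T)
      ≡⟨ insert′-++ (row c a ∷ T) L≤a (firstAbove-≤ {a} {a} (replicate (c a) a) T ℕ.≤-refl) ⟩
    stack c L [] ++ bump a (row c a ∷ T)
      ≡⟨ cong (stack c L [] ++_) (bump-append {a} {row c a} T (replicate⁺ _ ℕ.≤-refl) fa) ⟩
    stack c L [] ++ (row c a ++ [ a ]) ∷ T
      ≡⟨ cong₂ (λ U r → U ++ r ∷ T) (stack-cong L [] below) grown ⟩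
    stack c′ L [] ++ row c′ a ∷ T
      ≡⟨ stack-++ c′ L _ ⟨
    stack c′ L (row c′ a ∷ T) ∎
    where
    open ≡-Reasoning
    L = lettersBelow (toℕ a) (<⇒≤ k<n)
    c′ = λ i → c i + count i [ a ]
    L≤a : All (All (_≤ a)) (stack c L [])
    L≤a = stack-All c (All.map <⇒≤ (lettersBelow-< (toℕ a) _)) []
    below : All (λ i → c i ≡ c′ i) L
    below = All.map (λ i<a → sym (+-count-≢ c (λ a≡i → <⇒≢ i<a (sym a≡i)))) (lettersBelow-< (toℕ a) _)
    grown : row c a ++ [ a ] ≡ row c′ a
    grown = trans (replicate-∷ʳ (suc (c a)) a)
                  (cong (λ m → replicate (suc m) a)
                        (trans (ℕ.+-comm 1 (c a)) (cong (c a +_) (sym (count-≡ a [])))))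

  insertAll-stack : ∀ c w → insertAll (stack c decreasing []) w ≡ stack (λ i → c i + count i w) decreasing []
  insertAll-stack c []      =
    stack-cong decreasing [] (All.universal (λ i → sym (+-identityʳ (c i))) decreasing)
  insertAll-stack c (x ∷ w) = begin
    insertAll (insert′ x (stack c decreasing [])) w
      ≡⟨ cong (λ T → insertAll T w) (insert′-stack c n ℕ.≤-refl [] (toℕ<n x) refl) ⟩
    insertAll (stack c′ decreasing []) w
      ≡⟨ insertAll-stack c′ w ⟩
    stack (λ i → c′ i + count i w) decreasing []
      ≡⟨ stack-cong decreasing [] (All.universal regroup decreasing) ⟩
    stack (λ i → c i + count i (x ∷ w)) decreasing [] ∎
    where
    open ≡-Reasoning
    c′ = λ i → c i + count i [ x ]
    regroup : ∀ i → c′ i + count i w ≡ c i + count i (x ∷ w)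
    regroup i = trans (+-assoc (c i) _ _) (cong (c i +_) (sym (count-++ i [ x ] w)))

  insert′-All : ∀ {P : Fin n → Set} {a T} → P a → All (All P) T → All (All P) (insert′ a T)
  insert′-All {a = a} {T} pa T-P =
    All.concat⁻ (↭.All-resp-↭ (↭-sym (insert′-↭ a T)) (pa ∷ All.concat⁺ T-P))

  content-insert′-≡ : ∀ a T → content (insert′ a T) a ≡ suc (content T a)
  content-insert′-≡ a T = trans (content-insert′ a T a) (cong (_+ content T a) (count-≡ a []))

  content-insert′-≢ : ∀ {a i} T → a ≢ i → content (insert′ a T) i ≡ content T i
  content-insert′-≢ {a} {i} T a≢i =
    trans (content-insert′ a T i) (cong (_+ content T i) (count-≢ [] a≢i))

  content-step : ∀ {a h m i} P Q P₂ → insert′ a (P ++ Q) ≡ P₂ ++ replicate m h ∷ Q → h ≢ i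
               → content P₂ i ≡ count i [ a ] + content P i
  content-step {a} {h} {m} {i} P Q P₂ eq h≢i = +-cancelʳ-≡ (content Q i) _ _ (begin
    content P₂ i + content Q i
      ≡⟨ cong (λ k → content P₂ i + (k + content Q i)) (count-none i (replicate⁺ m h≢i)) ⟨
    content P₂ i + (count i (replicate m h) + content Q i)
      ≡⟨ cong (content P₂ i +_) (count-++ i (replicate m h) (concat Q)) ⟨
    content P₂ i + content (replicate m h ∷ Q) i
      ≡⟨ content-++ P₂ _ i ⟨
    content (P₂ ++ replicate m h ∷ Q) i
      ≡⟨ cong (λ T → content T i) eq ⟨
    content (insert′ a (P ++ Q)) i
      ≡⟨ content-insert′ a (P ++ Q) i ⟩
    count i [ a ] + content (P ++ Q) i
      ≡⟨ cong (count i [ a ] +_) (content-++ P Q i) ⟩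
    count i [ a ] + (content P i + content Q i)
      ≡⟨ +-assoc (count i [ a ]) _ _ ⟨
    count i [ a ] + content P i + content Q i ∎)
    where open ≡-Reasoning

  ribbonRow-≥ : ∀ {h x} r {rs} → IsRibbonRow x r rs → toℕ h ℕ.≤ x → All (_≤ h) r → All (All (_≤ h)) rs
              → All (_≡ h) r × rs ≡ []
  ribbonRow-≥ [] {[]}            _            _   _ _ = [] , refl
  ribbonRow-≥ [] {(_ ∷ _) ∷ _}  (x<y , _)    h≤x _ ((y≤h ∷ _) ∷ _) =
    contradiction (ℕ.≤-trans y≤h h≤x) (<⇒≱ x<y)
  ribbonRow-≥ (z ∷ zs)          (x≤z , ρ)    h≤x (z≤h ∷ zs≤h) rs≤h =
    let zs≡h , rs≡[] = ribbonRow-≥ zs ρ h≤z zs≤h rs≤h in ≤-antisym z≤h h≤z ∷ zs≡h , rs≡[]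
    where h≤z = ℕ.≤-trans h≤x x≤z

  ribbonRow-below : ∀ {x} r {y ys rs} → IsRibbonRow x r ((y ∷ ys) ∷ rs) → x ℕ.< toℕ y × All (_< y) r
  ribbonRow-below []       (x<y , _) = x<y , []
  ribbonRow-below (z ∷ zs) (x≤z , ρ) =
    let z<y , zs<y = ribbonRow-below zs ρ in ℕ.≤-<-trans x≤z z<y , z<y ∷ zs<y

  module TopLetter {a h : Fin n} (h≡1+a : toℕ h ≡ suc (toℕ a)) where

    a<h : a < h
    a<h = ℕ.≤-reflexive (sym h≡1+a)

    <h⇒≤a : ∀ {x : Fin n} → x < h → x ≤ a
    <h⇒≤a x<h = s≤s⁻¹ (subst (ℕ._≤_ _) h≡1+a x<h)

    >a⇒≥h : ∀ {x : Fin n} → a < x → h ≤ x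
    >a⇒≥h a<x = subst (ℕ._≤ _) (sym h≡1+a) a<x

    ≤a⇒≢h : ∀ {x : Fin n} → x ≤ a → x ≢ h
    ≤a⇒≢h x≤a refl = <⇒≱ a<h x≤a

    lastRow-shape : ∀ {x} r → IsRibbonRow x r [] → All (_≤ h) r
                  → r ≡ takeWhile (_≤? a) r ++ replicate (count h r) h
    lastRow-shape []       _       _            = refl
    lastRow-shape (z ∷ zs) (_ , ρ) (z≤h ∷ zs≤h) with ≤∨> z a
    ... | inj₁ z≤a rewrite takeWhile-≤ zs z≤a | count-≢ zs (≤a⇒≢h z≤a) =
      cong (z ∷_) (lastRow-shape zs ρ zs≤h)
    ... | inj₂ a<z rewrite takeWhile-> zs a<z =
      All≡⇒replicate (≤-antisym z≤h (>a⇒≥h a<z) ∷ proj₁ (ribbonRow-≥ zs ρ (>a⇒≥h a<z) zs≤h []))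

    data LastRowView (m : ℕ) : Tableau → Set where
      sharedRow : ∀ {Lo z zs} → All (All (_≤ a)) Lo → All (_≤ a) (z ∷ zs)
                → LastRowView m (Lo ++ [ (z ∷ zs) ++ replicate m h ])
      ownRow    : ∀ {Lo z zs} → All (All (_≤ a)) Lo → All (_≤ a) (z ∷ zs)
                → LastRowView m (Lo ++ (z ∷ zs) ∷ [ replicate m h ])
      onlyRow   : LastRowView m [ replicate m h ]

    singleRowView : ∀ m {s} → All (_≤ a) s → LastRowView m [ s ++ replicate m h ]
    singleRowView m []         = onlyRow
    singleRowView m s≤a@(_ ∷ _) = sharedRow [] s≤a

    LastRowView-∷ : ∀ {m z zs P} → All (_≤ a) (z ∷ zs) → LastRowView m P → LastRowView m ((z ∷ zs) ∷ P)
    LastRowView-∷ r≤a (sharedRow Lo≤a s≤a) = sharedRow (r≤a ∷ Lo≤a) s≤a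
    LastRowView-∷ r≤a (ownRow Lo≤a s≤a)    = ownRow (r≤a ∷ Lo≤a) s≤a
    LastRowView-∷ r≤a onlyRow              = ownRow [] r≤a

    lastRowView : ∀ {x} z zs rs → IsRibbonRow x (z ∷ zs) rs → All (All (_≤ h)) ((z ∷ zs) ∷ rs)
                → LastRowView (content ((z ∷ zs) ∷ rs) h) ((z ∷ zs) ∷ rs)
    lastRowView z zs [] ρ (r≤h ∷ []) =
      subst₂ LastRowView (cong (count h) (sym (++-identityʳ (z ∷ zs))))
                         (cong [_] (sym (lastRow-shape (z ∷ zs) ρ r≤h)))
        (singleRowView (count h (z ∷ zs)) (All.all-takeWhile (_≤? a) (z ∷ zs)))
    lastRowView z zs ([] ∷ rs) ρ _ = ⊥-elim (proj₂ (IsRibbonRow-rest (z ∷ zs) ρ))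
    lastRowView z zs ((y ∷ ys) ∷ rs) ρ (r≤h ∷ rest≤h@((y≤h ∷ _) ∷ _)) =
      subst (λ m → LastRowView m _) (sym content-rest)
        (LastRowView-∷ r≤a (lastRowView y ys rs (proj₂ (IsRibbonRow-rest (z ∷ zs) ρ)) rest≤h))
      where
      r≤a : All (_≤ a) (z ∷ zs)
      r≤a = All.map (λ x<y → <h⇒≤a (ℕ.<-≤-trans x<y y≤h)) (proj₂ (ribbonRow-below (z ∷ zs) ρ))
      content-rest : content ((z ∷ zs) ∷ (y ∷ ys) ∷ rs) h ≡ content ((y ∷ ys) ∷ rs) h
      content-rest = trans (count-++ h (z ∷ zs) _)
                           (cong (_+ content ((y ∷ ys) ∷ rs) h) (count-none h (All.map ≤a⇒≢h r≤a)))

    insert′-LastRowView : ∀ {m P} Q → 0 ℕ.< m → LastRowView m P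
      → ∃₂ λ Lo s → insert′ a (P ++ Q) ≡ (Lo ++ [ s ++ [ a ] ]) ++ replicate m h ∷ Q
                  × All (All (_≤ a)) Lo × All (_≤ a) s
    insert′-LastRowView {suc m} Q _ (sharedRow {Lo} {z} {zs} Lo≤a s≤a@(z≤a ∷ _)) = Lo , z ∷ zs , (begin
      insert′ a ((Lo ++ [ (z ∷ zs) ++ H ]) ++ Q)
        ≡⟨ cong (insert′ a) (++-assoc Lo _ Q) ⟩
      insert′ a (Lo ++ ((z ∷ zs) ++ H) ∷ Q)
        ≡⟨ insert′-++ _ Lo≤a (firstAbove-≤ (zs ++ H) Q z≤a) ⟩
      Lo ++ bump a (((z ∷ zs) ++ H) ∷ Q)
        ≡⟨ cong (Lo ++_) (bump-split (replicate m h) Q s≤a a<h) ⟩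
      Lo ++ ((z ∷ zs) ++ [ a ]) ∷ H ∷ Q
        ≡⟨ ++-assoc Lo _ _ ⟨
      (Lo ++ [ (z ∷ zs) ++ [ a ] ]) ++ H ∷ Q ∎) , Lo≤a , s≤a
      where
      open ≡-Reasoning
      H = replicate (suc m) h
    insert′-LastRowView {suc m} Q _ (ownRow {Lo} {z} {zs} Lo≤a s≤a@(z≤a ∷ _)) = Lo , z ∷ zs , (begin
      insert′ a ((Lo ++ (z ∷ zs) ∷ [ H ]) ++ Q)
        ≡⟨ cong (insert′ a) (++-assoc Lo _ Q) ⟩
      insert′ a (Lo ++ (z ∷ zs) ∷ H ∷ Q)
        ≡⟨ insert′-++ _ Lo≤a (firstAbove-≤ zs (H ∷ Q) z≤a) ⟩
      Lo ++ bump a ((z ∷ zs) ∷ H ∷ Q)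
        ≡⟨ cong (Lo ++_) (bump-append (H ∷ Q) s≤a (firstAbove-> (replicate m h) Q a<h)) ⟩
      Lo ++ ((z ∷ zs) ++ [ a ]) ∷ H ∷ Q
        ≡⟨ ++-assoc Lo _ _ ⟨
      (Lo ++ [ (z ∷ zs) ++ [ a ] ]) ++ H ∷ Q ∎) , Lo≤a , s≤a
      where
      open ≡-Reasoning
      H = replicate (suc m) h
    insert′-LastRowView {suc m} Q _ onlyRow =
      [] , [] , insert′-above (replicate (suc m) h ∷ Q) (firstAbove-> (replicate m h) Q a<h) , [] , []

    content-∷ʳ-pos : ∀ Lo s → 0 ℕ.< content (Lo ++ [ s ++ [ a ] ]) a
    content-∷ʳ-pos Lo s = filter-some (_≟ a)
      (subst (Any (_≡ a)) (concat-++ Lo _) (Any.++⁺ʳ (concat Lo) (Any.++⁺ˡ (Any.++⁺ʳ s (here refl)))))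

    insert′-separates : ∀ P Q → IsRibbon 0 P → All (All (_≤ h)) P → 0 ℕ.< content P h
      → ∃[ P₂ ] insert′ a (P ++ Q) ≡ P₂ ++ replicate (content P h) h ∷ Q
               × All (All (_≤ a)) P₂ × 0 ℕ.< content P₂ a
    insert′-separates ((z ∷ zs) ∷ rs) Q ρ P≤h pos
      with Lo , s , eq , Lo≤a , s≤a ← insert′-LastRowView Q pos (lastRowView z zs rs ρ P≤h) =
      Lo ++ [ s ++ [ a ] ] , eq , All.++⁺ Lo≤a (All.++⁺ s≤a (ℕ.≤-refl ∷ []) ∷ []) , content-∷ʳ-pos Lo s

  minimal-letter-row : ∀ {h} → toℕ h ≡ 0 → ∀ P → IsRibbon 0 P → All (All (_≤ h)) P → 0 ℕ.< content P h
                     → P ≡ [ replicate (content P h) h ]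
  minimal-letter-row h≡0 ((z ∷ zs) ∷ rs) ρ (r≤h ∷ rs≤h) _
    with r≡h , refl ← ribbonRow-≥ (z ∷ zs) ρ (ℕ.≤-reflexive h≡0) r≤h rs≤h =
    cong [_] (trans (All≡⇒replicate r≡h)
                    (cong (λ m → replicate m _) (cong (count _) (sym (++-identityʳ (z ∷ zs))))))

  -- Q holds the rows already split off; P the cells not yet sorted, its largest letter h included.
  insertAll-lettersBelow-++ : ∀ k (k≤n : k ℕ.≤ n) {h} → toℕ h ≡ k → ∀ P Q
    → IsRibbon 0 (P ++ Q) → All (All (_≤ h)) P → 0 ℕ.< content P h
    → insertAll (P ++ Q) (lettersBelow k k≤n) ≡ stack (content P) (lettersBelow k k≤n) (replicate (content P h) h ∷ Q)
  insertAll-lettersBelow-++ zero _ h≡0 P Q ρ P≤h pos =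
    cong (_++ Q) (minimal-letter-row h≡0 P (IsRibbon-++⁻ˡ P ρ) P≤h pos)
  insertAll-lettersBelow-++ (suc k) k<n {h} h≡1+k P Q ρ P≤h pos =
    let P₂ , eq , P₂≤a , pos₂ = insert′-separates P Q (IsRibbon-++⁻ˡ P ρ) P≤h pos in begin
    insertAll (insert′ a (P ++ Q)) L
      ≡⟨ cong (λ T → insertAll T L) eq ⟩
    insertAll (P₂ ++ H ∷ Q) L
      ≡⟨ insertAll-lettersBelow-++ k _ (toℕ-fromℕ< k<n) P₂ (H ∷ Q) (ρ₂ eq) P₂≤a pos₂ ⟩
    stack (content P₂) L (replicate (content P₂ a) a ∷ H ∷ Q)
      ≡⟨ stack-cong L _ (unchanged eq) ⟩
    stack (content P) L (replicate (content P₂ a) a ∷ H ∷ Q)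
      ≡⟨ cong (λ m → stack (content P) L (replicate m a ∷ H ∷ Q)) (grown eq) ⟩
    stack (content P) L (row (content P) a ∷ H ∷ Q) ∎
    where
    open ≡-Reasoning
    a = fromℕ< k<n
    L = lettersBelow k (<⇒≤ k<n)
    H = replicate (content P h) h
    h≡1+a : toℕ h ≡ suc (toℕ a)
    h≡1+a = trans h≡1+k (cong suc (sym (toℕ-fromℕ< k<n)))
    open TopLetter h≡1+a using (a<h; insert′-separates)
    ρ₂ : ∀ {P₂} → insert′ a (P ++ Q) ≡ P₂ ++ H ∷ Q → IsRibbon 0 (P₂ ++ H ∷ Q)
    ρ₂ eq = subst (IsRibbon 0) eq (insert′-IsRibbon (P ++ Q) ρ)
    unchanged : ∀ {P₂} → insert′ a (P ++ Q) ≡ P₂ ++ H ∷ Q → All (λ i → content P₂ i ≡ content P i) L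
    unchanged {P₂} eq = All.map (λ {i} i<k → let i<a = subst (toℕ i ℕ.<_) (sym (toℕ-fromℕ< k<n)) i<k in
      trans (content-step P Q P₂ eq (λ h≡i → <⇒≢ (ℕ.<-trans i<a a<h) (sym h≡i)))
            (cong (_+ content P i) (count-≢ [] (λ a≡i → <⇒≢ i<a (sym a≡i)))))
      (lettersBelow-< k (<⇒≤ k<n))
    grown : ∀ {P₂} → insert′ a (P ++ Q) ≡ P₂ ++ H ∷ Q → content P₂ a ≡ suc (content P a)
    grown {P₂} eq =
      trans (content-step P Q P₂ eq (λ h≡a → <⇒≢ a<h (sym h≡a))) (cong (_+ content P a) (count-≡ a []))

  insertAll-lettersBelow : ∀ k (k≤n : k ℕ.≤ n) T → IsRibbon 0 T → All (All (λ x → toℕ x ℕ.< k)) T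
                         → insertAll T (lettersBelow k k≤n) ≡ stack (content T) (lettersBelow k k≤n) []
  insertAll-lettersBelow zero    _   []                _ _                 = refl
  insertAll-lettersBelow zero    _   ((_ ∷ _) ∷ _)     _ ((() ∷ _) ∷ _)
  insertAll-lettersBelow (suc k) k<n T ρ T<1+k = begin
    insertAll (insert′ top T) L
      ≡⟨ cong (λ S → insertAll S L) (++-identityʳ P) ⟨
    insertAll (P ++ []) L
      ≡⟨ insertAll-lettersBelow-++ k _ (toℕ-fromℕ< k<n) P [] ρ′ P≤top pos ⟩
    stack (content P) L [ replicate (content P top) top ]
      ≡⟨ stack-cong L _ unchanged ⟩
    stack (content T) L [ replicate (content P top) top ]
      ≡⟨ cong (λ m → stack (content T) L [ replicate m top ]) (content-insert′-≡ top T) ⟩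
    stack (content T) L [ row (content T) top ] ∎
    where
    open ≡-Reasoning
    top = fromℕ< k<n
    L = lettersBelow k (<⇒≤ k<n)
    P = insert′ top T
    ρ′ : IsRibbon 0 (P ++ [])
    ρ′ = subst (IsRibbon 0) (sym (++-identityʳ P)) (insert′-IsRibbon T ρ)
    ≤top : ∀ {x : Fin n} → toℕ x ℕ.< suc k → x ≤ top
    ≤top x<1+k = subst (ℕ._≤_ _) (sym (toℕ-fromℕ< k<n)) (s≤s⁻¹ x<1+k)
    P≤top : All (All (_≤ top)) P
    P≤top = insert′-All ℕ.≤-refl (All.map (All.map ≤top) T<1+k)
    pos : 0 ℕ.< content P top
    pos = subst (0 ℕ.<_) (sym (content-insert′-≡ top T)) (s≤s z≤n)
    unchanged : All (λ i → content P i ≡ content T i) L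
    unchanged = All.map (λ {i} i<k → let i<top = subst (toℕ i ℕ.<_) (sym (toℕ-fromℕ< k<n)) i<k in
                           content-insert′-≢ T (λ top≡i → <⇒≢ i<top (sym top≡i)))
                        (lettersBelow-< k (<⇒≤ k<n))

  insertAll-IsRibbon : ∀ T w → IsRibbon 0 T → IsRibbon 0 (insertAll T w)
  insertAll-IsRibbon T []      ρ = ρ
  insertAll-IsRibbon T (x ∷ w) ρ = insertAll-IsRibbon (insert′ x T) w (insert′-IsRibbon T ρ)

  foldl-insert≡insertAll : ∀ T w → IsRibbon 0 T → foldl (λ T a → insert a T) T w ≡ insertAll T w
  foldl-insert≡insertAll T []      _ = refl
  foldl-insert≡insertAll T (x ∷ w) ρ =
    trans (cong (λ S → foldl (λ T a → insert a T) S w) (insert≡insert′ x T ρ))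
          (foldl-insert≡insertAll (insert′ x T) w (insert′-IsRibbon T ρ))

  canonical : Vec ℕ n → Tableau
  canonical c = stack (lookup c) decreasing []

  lookup-wt : ∀ w i → lookup (wt w) i ≡ count i w
  lookup-wt w i = lookup∘tabulate (λ j → count j w) i

  QR-++-decreasing : ∀ w → QR (w ++ decreasing) ≡ canonical (wt w)
  QR-++-decreasing w = begin
    QR (w ++ decreasing)
      ≡⟨ foldl-insert≡insertAll [] (w ++ decreasing) tt ⟩
    insertAll [] (w ++ decreasing)
      ≡⟨ foldl-++ _ [] w decreasing ⟩
    insertAll (insertAll [] w) decreasing
      ≡⟨ insertAll-lettersBelow n ℕ.≤-refl _ (insertAll-IsRibbon [] w tt) (All.universal (All.universal toℕ<n) _) ⟩
    stack (content (insertAll [] w)) decreasing []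
      ≡⟨ stack-cong decreasing [] (All.universal content≡ decreasing) ⟩
    canonical (wt w) ∎
    where
    open ≡-Reasoning
    content≡ : ∀ i → content (insertAll [] w) i ≡ lookup (wt w) i
    content≡ i = trans (content-insertAll [] w i) (trans (+-identityʳ (count i w)) (sym (lookup-wt w i)))

  QR-decreasing-++ : ∀ w → QR (decreasing ++ w) ≡ canonical (wt w)
  QR-decreasing-++ w = begin
    QR (decreasing ++ w)
      ≡⟨ foldl-insert≡insertAll [] (decreasing ++ w) tt ⟩
    insertAll [] (decreasing ++ w)
      ≡⟨ foldl-++ _ [] decreasing w ⟩
    insertAll (insertAll [] decreasing) w
      ≡⟨ cong (λ T → insertAll T w) (insertAll-lettersBelow n ℕ.≤-refl [] tt []) ⟩
    insertAll (stack (content []) decreasing []) w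
      ≡⟨ insertAll-stack (content []) w ⟩
    stack (λ i → count i w) decreasing []
      ≡⟨ stack-cong decreasing [] (All.universal (λ i → sym (lookup-wt w i)) decreasing) ⟩
    canonical (wt w) ∎
    where open ≡-Reasoning

proposition9p2 : (n : ℕ) (u v : Word n) → wt u ≡ wt v → OConjugate u v
proposition9p2 n u v wt≡ = decreasing , decreasing , u·g≡g·v , h·u≡v·h
  where
  open ≡-Reasoning
  u·g≡g·v : QR (u ++ decreasing) ≡ QR (decreasing ++ v)
  u·g≡g·v = begin
    QR (u ++ decreasing)  ≡⟨ QR-++-decreasing u ⟩
    canonical (wt u)      ≡⟨ cong canonical wt≡ ⟩
    canonical (wt v)      ≡⟨ QR-decreasing-++ v ⟨
    QR (decreasing ++ v)  ∎
  h·u≡v·h : QR (decreasing ++ u) ≡ QR (v ++ decreasing)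
  h·u≡v·h = begin
    QR (decreasing ++ u)  ≡⟨ QR-decreasing-++ u ⟩
    canonical (wt u)      ≡⟨ cong canonical wt≡ ⟩
    canonical (wt v)      ≡⟨ QR-++-decreasing v ⟨
    QR (v ++ decreasing)  ∎
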